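{- Let $k\geq 2$, let $\mathbf{B}$ be a $\tau$-structure with universe $\{0,1\}$ all of whose relations are in $k$-IHS-B$+$, and let $\mathbf{A}$ be a finite $\tau$-structure that is not homomorphic to $\mathbf{B}$. Then there exist elements $a^i_j\in A$, $1\leq i\leq k$, $1\leq j\leq l_i$ (for some $l_i\geq 1$), such that $(a^1_1\rightarrow 0,\dots,a^k_1\rightarrow 0)$ is a forbidden partial mapping, $(a^i_{l_i}\rightarrow 1)$ is a forbidden partial mapping for each $1\leq i\leq k$, and $(a^i_j\rightarrow 1,a^i_{j+1}\rightarrow 0)$ is a forbidden partial mapping for each $1\leq i\leq k$ and $1\leq j\leq l_i-1$.
   Context: A vocabulary $\tau$ is a finite set of relation symbols with arities $\rho(R)$; a $\tau$-structure has a universe and a relation $R^{\mathbf{A}}$ of arity $\rho(R)$ for each $R\in\tau$. A homomorphism is a map between universes preserving all relations. A Boolean relation $R\subseteq\{0,1\}^r$ is in $k$-IHS-B$+$ if it is the set of satisfying assignments of a CNF formula each of whose clauses has the form $\neg v$, $\neg v\vee w$, or $w_1\vee\dots\vee w_k$. For a relation $T$ of arity $r$ and indices $i_1,\dots,i_m\in\{1,\dots,r\}$ (not necessarily distinct), $T_{|i_1,\dots,i_m}=\{(t_{i_1},\dots,t_{i_m}):(t_1,\dots,t_r)\in T\}$. A list $(a_1\rightarrow b_1,\dots,a_m\rightarrow b_m)$ with $a_i\in A$, $b_i\in B$ is a forbidden partial mapping (for $\mathbf{A}$ and $\mathbf{B}$) if there exist $R\in\tau$ and indices $i_1,\dots,i_m\in\{1,\dots,\rho(R)\}$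 such that $(a_1,\dots,a_m)\in R^{\mathbf{A}}_{|i_1,\dots,i_m}$ and $(b_1,\dots,b_m)\notin R^{\mathbf{B}}_{|i_1,\dots,i_m}$. -}

module Defs where

open import Data.Nat using (ℕ; zero; suc)
open import Data.Fin using (Fin)
open import Data.Bool using (Bool; true; false)
open import Data.Vec using (Vec; map; lookup)
open import Data.List using (List)
open import Data.List.Relation.Unary.All using (All)
open import Data.List.Membership.Propositional using (_∈_)
open import Data.Product using (Σ; ∃; _×_; _,_)
open import Data.Sum using (_⊎_)
open import Relation.Nullary using (¬_)
open import Relation.Binary.PropositionalEquality using (_≡_)

record Vocabulary : Set where
  field
    nsym  : ℕ
    arity : Fin nsym → ℕ
open Vocabulary public

record FinStructure (τ : Vocabulary) : Set where
  field
    size : ℕ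
    rel  : (R : Fin (nsym τ)) → List (Vec (Fin size) (arity τ R))
open FinStructure public

-- A τ-structure with universe {0,1} (false = 0, true = 1).
record BoolStructure (τ : Vocabulary) : Set₁ where
  field
    brel : (R : Fin (nsym τ)) → Vec Bool (arity τ R) → Set
open BoolStructure public

IsHom : {τ : Vocabulary} (A : FinStructure τ) (B : BoolStructure τ) → (Fin (size A) → Bool) → Set
IsHom {τ} A B h = ∀ (R : Fin (nsym τ)) (t : Vec (Fin (size A)) (arity τ R)) →
  t ∈ rel A R → brel B R (map h t)

Homomorphic : {τ : Vocabulary} (A : FinStructure τ) (B : BoolStructure τ) → Set
Homomorphic A B = ∃ λ h → IsHom A B h

-- Clauses of k-IHS-B+ over variables Fin r:  ¬v,  ¬v ∨ w,  w₁ ∨ … ∨ w_k.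
data Clause (k r : ℕ) : Set where
  negC : Fin r → Clause k r
  impC : Fin r → Fin r → Clause k r
  posC : Vec (Fin r) k → Clause k r

SatClause : {k r : ℕ} → Clause k r → Vec Bool r → Set
SatClause (negC v)   t = lookup t v ≡ false
SatClause (impC v w) t = lookup t v ≡ false ⊎ lookup t w ≡ true
SatClause {k} (posC ws) t = ∃ λ (j : Fin k) → lookup t (lookup ws j) ≡ true

SatCNF : {k r : ℕ} → List (Clause k r) → Vec Bool r → Set
SatCNF φ t = All (λ c → SatClause c t) φ

InIHSB+ : (k : ℕ) {r : ℕ} → (Vec Bool r → Set) → Set
InIHSB+ k {r} R = Σ (List (Clause k r)) λ φ →
  ∀ (t : Vec Bool r) → (R t → SatCNF φ t) × (SatCNF φ t → R t)

proj : {X : Set} {r m : ℕ} → Vec (Fin r) m → Vec X r → Vec X m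
proj is t = map (lookup t) is

Forbidden : {τ : Vocabulary} (A : FinStructure τ) (B : BoolStructure τ) {m : ℕ} →
  Vec (Fin (size A)) m → Vec Bool m → Set
Forbidden {τ} A B {m} as bs =
  Σ (Fin (nsym τ)) λ R → Σ (Vec (Fin (arity τ R)) m) λ is →
    (∃ λ t → t ∈ rel A R × proj is t ≡ as)
    × ¬ (∃ λ t → brel B R t × proj is t ≡ bs)

-- Maintain a set U of candidates for the value 1 such that every element outside U is forced
-- to 0 by a chain a₁ → 1, a₂ → 0, …, a_l → 1 of forbidden partial mappings.  The
-- characteristic map of U is not a homomorphism, so it falsifies some clause on some tuple of A,
-- and the values the clause's variables take there form a forbidden partial mapping.  A
-- falsified ¬v or ¬v ∨ w exhibits a forced element of U (for ¬v ∨ w, prepend v to the chain of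
-- w, which lies outside U), which is removed.  As U cannot shrink forever, eventually some
-- w₁ ∨ … ∨ w_k is falsified: all k values lie outside U, and their chains together with the
-- forbidden all-zero tuple form the required obstruction.
{-# OPTIONS --safe #-}
module Submission where

open import Defs
open import Data.Nat using (ℕ; suc; _≤_; _<_)
open import Data.Nat.Induction using (<-wellFounded)
open import Data.Fin using (Fin; zero; suc; fromℕ; inject₁; _≟_)
open import Data.Fin.Properties using (¬∀⟶∃¬; any?)
open import Data.Fin.Subset using (Subset; ⊤; _-_; ∣_∣) renaming (_∈_ to _∈ₛ_; _∉_ to _∉ₛ_)
open import Data.Fin.Subset.Properties using (∈⊤; x∈p⇒∣p-x∣<∣p∣; x∈p∧x≢y⇒x∈p-y)
open import Data.Bool using (Bool; true; false)
open import Data.Bool.Properties using (not-¬; ¬-not) renaming (_≟_ to _≟ᵇ_)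
open import Data.Vec using (Vec; tabulate; replicate; map; lookup; _∷_; [])
open import Data.Vec.Properties
  using (map-cong; map-∘; lookup-map; lookup-replicate; tabulate∘lookup; tabulate-cong;
         ∷-injectiveˡ; ∷-injectiveʳ; []=⇒lookup; lookup⇒[]=)
open import Data.List using (List)
import Data.List.Relation.Unary.All as All
open import Data.List.Relation.Unary.All.Properties using (¬All⇒Any¬)
open import Data.List.Membership.Propositional using (_∈_; find)
open import Data.Product using (Σ; ∃; ∃₂; _×_; _,_; proj₁; proj₂)
open import Data.Sum using (_⊎_; inj₁; inj₂)
open import Data.Empty using (⊥-elim)
open import Function using (_∘_)
open import Induction.WellFounded using (Acc; acc)
open import Relation.Nullary using (¬_; Dec; yes; no; _⊎-dec_)
open import Relation.Binary.PropositionalEquality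
  using (_≡_; _≢_; refl; sym; trans; cong; cong₂; subst)
open import Relation.Binary.PropositionalEquality.Properties using (module ≡-Reasoning)

module _ {A B : Set} {m : ℕ} where

  map≡replicate⇒lookup : (f : A → B) (xs : Vec A m) {b : B} →
    map f xs ≡ replicate m b → ∀ i → f (lookup xs i) ≡ b
  map≡replicate⇒lookup f xs {b} eq i = begin
    f (lookup xs i)          ≡⟨ lookup-map i f xs ⟨
    lookup (map f xs) i      ≡⟨ cong (λ ys → lookup ys i) eq ⟩
    lookup (replicate m b) i ≡⟨ lookup-replicate i b ⟩
    b                        ∎
    where open ≡-Reasoning

  proj-map : ∀ {l} (f : A → B) (is : Vec (Fin m) l) (t : Vec A m) →
    proj is (map f t) ≡ map f (proj is t)
  proj-map f is t = trans (map-cong (λ i → lookup-map i f t) is) (map-∘ f (lookup t) is)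

lookup≡false⇒∉ : ∀ {n} {p : Subset n} {x} → lookup p x ≡ false → x ∉ₛ p
lookup≡false⇒∉ x↦0 x∈p = not-¬ ([]=⇒lookup x∈p) x↦0

none-true⇒all-false : ∀ {m} (bs : Vec Bool m) →
  (∀ j → lookup bs j ≢ true) → bs ≡ replicate m false
none-true⇒all-false []       _     = refl
none-true⇒all-false (b ∷ bs) ¬true =
  cong₂ _∷_ (¬-not (¬true zero)) (none-true⇒all-false bs (¬true ∘ suc))

module _ {k r : ℕ} where

  width : Clause k r → ℕ
  width (negC _)   = 1
  width (impC _ _) = 2
  width (posC _)   = k

  vars : (c : Clause k r) → Vec (Fin r) (width c)
  vars (negC v)   = v ∷ []
  vars (impC v w) = v ∷ w ∷ []
  vars (posC ws)  = ws

  falsifier : (c : Clause k r) → Vec Bool (width c)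
  falsifier (negC _)   = true ∷ []
  falsifier (impC _ _) = true ∷ false ∷ []
  falsifier (posC _)   = replicate k false

  falsifier⇒¬sat : (c : Clause k r) (u : Vec Bool r) →
    proj (vars c) u ≡ falsifier c → ¬ SatClause c u
  falsifier⇒¬sat (negC v)   u eq v≡0        = not-¬ (∷-injectiveˡ eq) v≡0
  falsifier⇒¬sat (impC v w) u eq (inj₁ v≡0) = not-¬ (∷-injectiveˡ eq) v≡0
  falsifier⇒¬sat (impC v w) u eq (inj₂ w≡1) = not-¬ (∷-injectiveˡ (∷-injectiveʳ eq)) w≡1
  falsifier⇒¬sat (posC ws)  u eq (j , wⱼ≡1) =
    not-¬ (map≡replicate⇒lookup (lookup u) ws eq j) wⱼ≡1

  ¬sat⇒falsifier : (c : Clause k r) (u : Vec Bool r) →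
    ¬ SatClause c u → proj (vars c) u ≡ falsifier c
  ¬sat⇒falsifier (negC v)   u ¬sat = cong (_∷ []) (¬-not ¬sat)
  ¬sat⇒falsifier (impC v w) u ¬sat =
    cong₂ (λ a b → a ∷ b ∷ []) (¬-not (¬sat ∘ inj₁)) (¬-not (¬sat ∘ inj₂))
  ¬sat⇒falsifier (posC ws)  u ¬sat = none-true⇒all-false (proj ws u)
    (λ j wⱼ≡1 → ¬sat (j , trans (sym (lookup-map j (lookup u) ws)) wⱼ≡1))

  satClause? : (c : Clause k r) (u : Vec Bool r) → Dec (SatClause c u)
  satClause? (negC v)   u = lookup u v ≟ᵇ false
  satClause? (impC v w) u = (lookup u v ≟ᵇ false) ⊎-dec (lookup u w ≟ᵇ true)
  satClause? (posC ws)  u = any? (λ j → lookup u (lookup ws j) ≟ᵇ true)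

  satCNF? : (φ : List (Clause k r)) (u : Vec Bool r) → Dec (SatCNF φ u)
  satCNF? φ u = All.all? (λ c → satClause? c u) φ

module _ {τ : Vocabulary} (A : FinStructure τ) (B : BoolStructure τ) where

  data ForcedFalse : Fin (size A) → Set where
    forced-here : ∀ {x} → Forbidden A B (x ∷ []) (true ∷ []) → ForcedFalse x
    forced-step : ∀ {x y} → Forbidden A B (x ∷ y ∷ []) (true ∷ false ∷ []) →
                  ForcedFalse y → ForcedFalse x

  steps : ∀ {x} → ForcedFalse x → ℕ
  steps (forced-here _)   = 0
  steps (forced-step _ p) = suc (steps p)

  chain : ∀ {x} (p : ForcedFalse x) → Fin (suc (steps p)) → Fin (size A)
  chain {x} (forced-here _)   _       = x
  chain {x} (forced-step _ p) zero    = x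
  chain     (forced-step _ p) (suc j) = chain p j

  chain-head : ∀ {x} (p : ForcedFalse x) → chain p zero ≡ x
  chain-head (forced-here _)   = refl
  chain-head (forced-step _ _) = refl

  chain-last : ∀ {x} (p : ForcedFalse x) →
    Forbidden A B (chain p (fromℕ (steps p)) ∷ []) (true ∷ [])
  chain-last (forced-here f)   = f
  chain-last (forced-step _ p) = chain-last p

  chain-step : ∀ {x} (p : ForcedFalse x) (j : Fin (steps p)) →
    Forbidden A B (chain p (inject₁ j) ∷ chain p (suc j) ∷ []) (true ∷ false ∷ [])
  chain-step {x} (forced-step f p) zero =
    subst (λ y → Forbidden A B (x ∷ y ∷ []) (true ∷ false ∷ [])) (sym (chain-head p)) f
  chain-step (forced-step _ p) (suc j) = chain-step p j

  Obstruction : ℕ → Set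
  Obstruction k =
    Σ (Fin k → ℕ) λ l′ →
    Σ ((i : Fin k) → Fin (suc (l′ i)) → Fin (size A)) λ a →
      Forbidden A B (tabulate (λ i → a i zero)) (replicate k false)
      × (∀ (i : Fin k) → Forbidden A B (a i (fromℕ (l′ i)) ∷ []) (true ∷ []))
      × (∀ (i : Fin k) (j : Fin (l′ i)) →
           Forbidden A B (a i (inject₁ j) ∷ a i (suc j) ∷ []) (true ∷ false ∷ []))

  forced-obstruction : ∀ {k} (s : Vec (Fin (size A)) k) →
    Forbidden A B s (replicate k false) → (∀ i → ForcedFalse (lookup s i)) → Obstruction k
  forced-obstruction s f forced =
    steps ∘ forced , chain ∘ forced ,
    subst (λ s′ → Forbidden A B s′ _) heads≡s f ,
    chain-last ∘ forced ,
    chain-step ∘ forced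
    where
    heads≡s : s ≡ tabulate (λ i → chain (forced i) zero)
    heads≡s = trans (sym (tabulate∘lookup s)) (tabulate-cong (sym ∘ chain-head ∘ forced))

  record Violation (k : ℕ) (h : Fin (size A) → Bool) : Set where
    field
      {arity′}          : ℕ
      clause            : Clause k arity′
      tuple             : Vec (Fin (size A)) (width clause)
      maps-to-falsifier : map h tuple ≡ falsifier clause
      forbidden         : Forbidden A B tuple (falsifier clause)

  OutsideForced : Subset (size A) → Set
  OutsideForced U = ∀ x → x ∉ₛ U → ForcedFalse x

  ForcedMember : Subset (size A) → Set
  ForcedMember U = ∃ λ x → x ∈ₛ U × ForcedFalse x

  remove-forced : ∀ {U x} → OutsideForced U → ForcedFalse x → OutsideForced (U - x)
  remove-forced {U} {x} out x-forced y y∉U-x with y ≟ x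
  ... | yes refl = x-forced
  ... | no  y≢x  = out y (λ y∈U → y∉U-x (x∈p∧x≢y⇒x∈p-y y∈U y≢x))

  resolve : ∀ {k U} → OutsideForced U → Violation k (lookup U) →
    ForcedMember U ⊎ Obstruction k
  resolve {U = U} out record { clause = negC _ ; tuple = x ∷ [] ; maps-to-falsifier = x↦1
                             ; forbidden = f } =
    inj₁ (x , lookup⇒[]= x U (∷-injectiveˡ x↦1) , forced-here f)
  resolve {U = U} out record { clause = impC _ _ ; tuple = x ∷ y ∷ [] ; maps-to-falsifier = xy↦10
                             ; forbidden = f } =
    inj₁ (x , lookup⇒[]= x U (∷-injectiveˡ xy↦10) ,
          forced-step f (out y (lookup≡false⇒∉ (∷-injectiveˡ (∷-injectiveʳ xy↦10)))))
  resolve {U = U} out record { clause = posC _ ; tuple = s ; maps-to-falsifier = s↦0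
                             ; forbidden = f } =
    inj₂ (forced-obstruction s f λ i →
            out (lookup s i) (lookup≡false⇒∉ (map≡replicate⇒lookup (lookup U) s s↦0 i)))

module _ {τ : Vocabulary} {k : ℕ} (A : FinStructure τ) (B : BoolStructure τ)
         (B-cnf : ∀ R → InIHSB+ k (brel B R)) where

  cnf : (R : Fin (nsym τ)) → List (Clause k (arity τ R))
  cnf R = proj₁ (B-cnf R)

  falsifier-forbidden : ∀ {R t c} → t ∈ rel A R → c ∈ cnf R →
    Forbidden A B (proj (vars c) t) (falsifier c)
  falsifier-forbidden {R} {t} {c} t∈A c∈φ =
    R , vars c , (t , t∈A , refl) , λ (u , u∈B , u↦falsifier) →
      falsifier⇒¬sat c u u↦falsifier (All.lookup (proj₁ (proj₂ (B-cnf R) u) u∈B) c∈φ)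

  falsified-clause : (h : Fin (size A) → Bool) → ¬ IsHom A B h →
    ∃₂ λ R t → t ∈ rel A R × ∃ λ c → c ∈ cnf R × ¬ SatClause c (map h t)
  falsified-clause h ¬hom =
    let R , ¬satR = ¬∀⟶∃¬ _ _ sat? (¬hom ∘ sat⇒hom)
        t , t∈A , ¬satₜ = find (¬All⇒Any¬ (satCNF? (cnf R) ∘ map h) _ ¬satR)
        c , c∈φ , ¬satc = find (¬All⇒Any¬ (λ c → satClause? c (map h t)) _ ¬satₜ)
    in R , t , t∈A , c , c∈φ , ¬satc
    where
    Sat : Fin (nsym τ) → Set
    Sat R = All.All (SatCNF (cnf R) ∘ map h) (rel A R)

    sat? : ∀ R → Dec (Sat R)
    sat? R = All.all? (satCNF? (cnf R) ∘ map h) (rel A R)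

    sat⇒hom : (∀ R → Sat R) → IsHom A B h
    sat⇒hom sat R t t∈A = proj₂ (proj₂ (B-cnf R) (map h t)) (All.lookup (sat R) t∈A)

  ¬hom⇒violation : (h : Fin (size A) → Bool) → ¬ IsHom A B h → Violation A B k h
  ¬hom⇒violation h ¬hom =
    let R , t , t∈A , c , c∈φ , ¬sat = falsified-clause h ¬hom
    in record
      { clause            = c
      ; tuple             = proj (vars c) t
      ; maps-to-falsifier =
          trans (sym (proj-map h (vars c) t)) (¬sat⇒falsifier c (map h t) ¬sat)
      ; forbidden         = falsifier-forbidden t∈A c∈φ
      }

  search : ¬ Homomorphic A B → (U : Subset (size A)) → Acc _<_ ∣ U ∣ → OutsideForced A B U →
    Obstruction A B k
  search ¬hom U (acc smaller) out
    with resolve A B out (¬hom⇒violation (lookup U) (¬hom ∘ (lookup U ,_)))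
  ... | inj₂ obstruction          = obstruction
  ... | inj₁ (x , x∈U , x-forced) =
    search ¬hom (U - x) (smaller (x∈p⇒∣p-x∣<∣p∣ x∈U)) (remove-forced A B out x-forced)

mainTheorem9 : (τ : Vocabulary) (k : ℕ) → 2 ≤ k →
    (B : BoolStructure τ) → (∀ R → InIHSB+ k (brel B R)) →
    (A : FinStructure τ) → ¬ Homomorphic A B →
    Σ (Fin k → ℕ) λ l′ →
    Σ ((i : Fin k) → Fin (suc (l′ i)) → Fin (size A)) λ a →
      Forbidden A B (tabulate (λ i → a i zero)) (replicate k false)
      × (∀ (i : Fin k) → Forbidden A B (a i (fromℕ (l′ i)) ∷ []) (true ∷ []))
      × (∀ (i : Fin k) (j : Fin (l′ i)) →
           Forbidden A B (a i (inject₁ j) ∷ a i (suc j) ∷ []) (true ∷ false ∷ []))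
mainTheorem9 τ k _ B B-cnf A ¬hom =
  search A B B-cnf ¬hom ⊤ (<-wellFounded _) (λ x x∉⊤ → ⊥-elim (x∉⊤ ∈⊤))
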